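{- Let $\mathcal H$ be a finite set of positive integers and $G$ a simple graph. Let $$g_{p,\mathcal H}(t,y)=\Big(\prod_{h\in\mathcal H}\big(y(yt+1)^h+t(y+t)^h\big)\Big)^{|V(G)|},\qquad g_{y,\mathcal H}(t,y)=y\prod_{h\in\mathcal H}\frac{yt(yt+1)^h+(y+t)^h}{y(yt+1)^h+t(y+t)^h}.$$ Then, as an identity of rational functions in $t,y$, $$Z(S_{\mathcal H}(G);t,y)=g_{p,\mathcal H}(t,y)\cdot Z\big(G;t,g_{y,\mathcal H}(t,y)\big).$$
   Context: $Z(G;t,y)=\sum_{S\subseteq V(G)} t^{|E_G(S)|+|E_G(\bar S)|}y^{|S|}$, where $\bar S=V(G)\setminus S$ and $E_G(S)$ (resp. $E_G(\bar S)$) is the set of edges with both endpoints in $S$ (resp. $\bar S$). $S_n$ is the star with $n$ leaves. $S_{\mathcal H}$ is obtained from the disjoint union of the stars $S_h$, $h\in\mathcal H$, and a new vertex $\mathrm{cent}(\mathcal H)$ by joining $\mathrm{cent}(\mathcal H)$ to the center of each $S_h$. $S_{\mathcal H}(G)$ is obtained from $G$ by taking, for each $v\in V(G)$, a new copy of $S_{\mathcal H}$ and identifying its vertex $\mathrm{cent}(\mathcal H)$ with $v$ (the rooted product of $G$ with $(S_{\mathcal H},\mathrm{cent}(\mathcal H))$). -}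

module Defs where

open import Level using (0ℓ)
open import Data.Bool using (Bool; true; false; _∧_; _∨_; not; if_then_else_)
open import Data.Nat using (ℕ; zero; suc)
import Data.Nat as ℕ
open import Data.Nat.ListAction using (sum)
open import Data.Fin using (Fin; zero; suc; splitAt; remQuot; toℕ)
open import Data.Fin.Properties using (_≟_; _<?_)
open import Data.Fin.Subset using (Subset; ∣_∣)
open import Data.Vec using (Vec; []; _∷_; lookup)
open import Data.List using (List; []; _∷_; map; concatMap; allFin; foldr)
open import Data.Sum using (inj₁; inj₂)
open import Data.Product using (_,_)
open import Relation.Nullary.Decidable using (⌊_⌋)
open import Relation.Binary.PropositionalEquality using (_≡_)
open import Algebra.Bundles using (CommutativeRing)

Adj : ℕ → Set
Adj n = Fin n → Fin n → Bool

record SimpleGraph (n : ℕ) : Set where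
  field
    adj     : Adj n
    adj-sym : ∀ i j → adj i j ≡ adj j i
    adj-irr : ∀ i → adj i i ≡ false
open SimpleGraph public

-- Edge counts.  An edge is an unordered pair {i,j}, counted once as i < j.

edgesIn : ∀ {n} → Adj n → (Fin n → Bool) → ℕ
edgesIn {n} a P =
  sum (concatMap (λ i → map (λ j →
         if ⌊ i <? j ⌋ ∧ a i j ∧ P i ∧ P j then 1 else 0) (allFin n))
       (allFin n))

allSubsets : ∀ n → List (Subset n)
allSubsets zero    = [] ∷ []
allSubsets (suc n) = concatMap (λ S → (true ∷ S) ∷ (false ∷ S) ∷ []) (allSubsets n)

module _ (R : CommutativeRing 0ℓ 0ℓ) where
  open CommutativeRing R

  pow : Carrier → ℕ → Carrier
  pow x zero    = 1#
  pow x (suc k) = x * pow x k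

  Σ-list : List Carrier → Carrier
  Σ-list = foldr _+_ 0#

  Π-list : List Carrier → Carrier
  Π-list = foldr _*_ 1#

  Z : ∀ {n} → Adj n → Carrier → Carrier → Carrier
  Z {n} a t y =
    Σ-list (map (λ S →
      pow t (edgesIn a (lookup S) ℕ.+ edgesIn a (λ i → not (lookup S i)))
        * pow y ∣ S ∣)
      (allSubsets n))

  den : Carrier → Carrier → ℕ → Carrier
  den t y h = y * pow (y * t + 1#) h + t * pow (y + t) h

  num : Carrier → Carrier → ℕ → Carrier
  num t y h = y * t * pow (y * t + 1#) h + pow (y + t) h

  g-p : List ℕ → ℕ → Carrier → Carrier → Carrier
  g-p H n t y = pow (Π-list (map (den t y) H)) n

  -- g_{y,H}(t,y) = y Π_{h∈H} num_h / den_h, where inv h is a given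
  -- inverse of den_h.
  g-y : List ℕ → (ℕ → Carrier) → Carrier → Carrier → Carrier
  g-y H inv t y = y * Π-list (map (λ h → num t y h * inv h) H)

-- The star S_h (h leaves) on Fin (suc h); vertex 0 is the centre.

starAdj : ∀ h → Adj (suc h)
starAdj h zero    zero    = false
starAdj h zero    (suc _) = true
starAdj h (suc _) zero    = true
starAdj h (suc _) (suc _) = false

-- Layout: S_{h ∷ H} has vertex set Fin (suc h + size H): first the star
-- S_h (its centre at index 0), then the vertices of S_H, which contain
-- cent(H).  S_[] is the single vertex cent.

size : List ℕ → ℕ
size []      = 1
size (h ∷ H) = suc h ℕ.+ size H

isCent : ∀ H → Fin (size H) → Bool
isCent []      _ = true
isCent (h ∷ H) i with splitAt (suc h) i
... | inj₁ _ = false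
... | inj₂ j = isCent H j

SHAdj : ∀ H → Adj (size H)
SHAdj []      _ _ = false
SHAdj (h ∷ H) i j with splitAt (suc h) i | splitAt (suc h) j
... | inj₁ a | inj₁ b = starAdj h a b
... | inj₁ a | inj₂ b = ⌊ a ≟ zero ⌋ ∧ isCent H b   -- centre of S_h ~ cent
... | inj₂ a | inj₁ b = isCent H a ∧ ⌊ b ≟ zero ⌋
... | inj₂ a | inj₂ b = SHAdj H a b

-- Rooted product S_H(G): vertex set Fin (n * size H), vertex (v , a)
-- is vertex a of the copy of S_H attached at v; the copy's cent is
-- identified with v.

rootedAdj : ∀ {n} → Adj n → (H : List ℕ) → Adj (n ℕ.* size H)
rootedAdj {n} adjG H x y with remQuot {n} (size H) x | remQuot {n} (size H) y
... | v , a | w , b =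
  (⌊ v ≟ w ⌋ ∧ SHAdj H a b) ∨ (isCent H a ∧ isCent H b ∧ adjG v w)

-- Colour the vertices of S_H(G) by membership in S. A monochromatic edge of S_H(G) lies either
-- inside one copy of S_H or is an edge of G between two roots, so summing out each copy of S_H
-- with the colour of its root fixed leaves a sum over colourings of G alone. Inside a copy, the
-- stars S_h hang independently off the root: with the root in S a star contributes
-- yt(yt+1)^h + (y+t)^h and the root itself y, with the root outside it contributes
-- y(yt+1)^h + t(y+t)^h. Factoring the second product out of every root leaves g_{y,H} per root
-- in S, i.e. Z(G; t, g_{y,H}).

module Submission where

open import Defs

open import Level using (0ℓ)
open import Algebra.Bundles using (CommutativeRing)
open import Function using (_∘_; id)
import Data.Nat as ℕ
open import Data.Nat using (ℕ; zero; suc; _≤_)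
open import Data.List.Relation.Unary.All using (All)
open import Data.List.Relation.Unary.Unique.Propositional using (Unique)
open import Data.Nat.ListAction using (sum)
open import Data.Nat.ListAction.Properties using (sum-++)
open import Data.Bool using (Bool; true; false; _∧_; _∨_; not; if_then_else_)
open import Data.Bool.Properties using (∧-assoc; ∧-zeroʳ; ∨-identityʳ)
open import Data.Fin using (Fin; zero; suc; toℕ; _↑ˡ_; _↑ʳ_; combine; remQuot)
open import Data.Fin.Properties
  using (_<?_; _≟_; toℕ-↑ˡ; toℕ-↑ʳ; toℕ<n; suc-injective; splitAt-↑ˡ; splitAt-↑ʳ; remQuot-combine; combine-remQuot)
open import Data.Fin.Subset using (Subset; ∣_∣)
open import Data.Vec using ([]; _∷_; lookup; tabulate; _++_)
open import Data.Vec.Properties using (lookup-++ˡ; lookup-++ʳ; lookup∘tabulate; tabulate∘lookup; tabulate-cong)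
import Data.List as List
open import Data.List using (List; []; _∷_; map; concatMap)
open import Data.Product using (_,_; proj₁; proj₂)
open import Data.List.Relation.Unary.Any using (here; there)
open import Data.List.Membership.Propositional using (_∈_)
open import Data.Empty using (⊥)
open import Relation.Nullary using (Dec; yes; no)
open import Relation.Nullary.Decidable using (⌊_⌋; isYes≗does; dec-true; dec-false)
open import Relation.Binary.PropositionalEquality as ≡ using (_≡_)

module _ where
  open import Relation.Binary.PropositionalEquality
    using (refl; sym; trans; cong; cong₂; subst; subst₂; module ≡-Reasoning)
  open import Data.Nat using (_+_; _*_; _<_)
  open import Data.Nat.Properties
    using (+-assoc; +-identityʳ; +-commutativeSemigroup; m≤m+n; ≤-trans; <⇒≤; <-irrefl; +-cancelˡ-<; +-monoʳ-<)
  open import Algebra.Properties.CommutativeSemigroup +-commutativeSemigroup using (interchange)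

  iverson : Bool → ℕ
  iverson b = if b then 1 else 0

  ∑ : ∀ N → (Fin N → ℕ) → ℕ
  ∑ zero    f = 0
  ∑ (suc N) f = f zero + ∑ N (f ∘ suc)

  ∑-cong : ∀ N {f g : Fin N → ℕ} → (∀ i → f i ≡ g i) → ∑ N f ≡ ∑ N g
  ∑-cong zero    f≗g = refl
  ∑-cong (suc N) f≗g = cong₂ _+_ (f≗g zero) (∑-cong N (f≗g ∘ suc))

  ∑-zero : ∀ N {f : Fin N → ℕ} → (∀ i → f i ≡ 0) → ∑ N f ≡ 0
  ∑-zero zero    f≗0 = refl
  ∑-zero (suc N) f≗0 = cong₂ _+_ (f≗0 zero) (∑-zero N (f≗0 ∘ suc))

  ∑-+ : ∀ N (f g : Fin N → ℕ) → ∑ N (λ i → f i + g i) ≡ ∑ N f + ∑ N g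
  ∑-+ zero    f g = refl
  ∑-+ (suc N) f g = trans (cong (f zero + g zero +_) (∑-+ N (f ∘ suc) (g ∘ suc)))
                          (interchange (f zero) (g zero) _ _)

  ∑-↑ : ∀ m K (f : Fin (m + K) → ℕ) → ∑ (m + K) f ≡ ∑ m (λ i → f (i ↑ˡ K)) + ∑ K (λ j → f (m ↑ʳ j))
  ∑-↑ zero    K f = refl
  ∑-↑ (suc m) K f = trans (cong (f zero +_) (∑-↑ m K (f ∘ suc))) (sym (+-assoc (f zero) _ _))

  ∑-swap : ∀ N M (f : Fin N → Fin M → ℕ) → ∑ N (λ i → ∑ M (f i)) ≡ ∑ M (λ j → ∑ N (λ i → f i j))
  ∑-swap zero    M f = sym (∑-zero M (λ _ → refl))
  ∑-swap (suc N) M f = trans (cong (∑ M (f zero) +_) (∑-swap N M (f ∘ suc)))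
                             (sym (∑-+ M (f zero) (λ j → ∑ N (λ i → f (suc i) j))))

  ∑-combine : ∀ n m (f : Fin (n * m) → ℕ) → ∑ (n * m) f ≡ ∑ n (λ v → ∑ m (λ a → f (combine v a)))
  ∑-combine zero    m f = refl
  ∑-combine (suc n) m f = trans (∑-↑ m (n * m) f) (cong (∑ m (λ a → f (a ↑ˡ (n * m))) +_) (∑-combine n m (f ∘ (m ↑ʳ_))))

  sum-map-tabulate : ∀ {A : Set} N (g : Fin N → A) (f : A → ℕ) → sum (map f (List.tabulate g)) ≡ ∑ N (f ∘ g)
  sum-map-tabulate zero    g f = refl
  sum-map-tabulate (suc N) g f = cong (f (g zero) +_) (sum-map-tabulate N (g ∘ suc) f)

  sum-concatMap-tabulate : ∀ {A : Set} N (g : Fin N → A) (f : A → List ℕ) →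
    sum (concatMap f (List.tabulate g)) ≡ ∑ N (sum ∘ f ∘ g)
  sum-concatMap-tabulate zero    g f = refl
  sum-concatMap-tabulate (suc N) g f =
    trans (sum-++ (f (g zero)) _) (cong (sum (f (g zero)) +_) (sum-concatMap-tabulate N (g ∘ suc) f))

  isYes-true : ∀ {P : Set} (p? : Dec P) → P → ⌊ p? ⌋ ≡ true
  isYes-true p? p = trans (isYes≗does p?) (dec-true p? p)

  isYes-false : ∀ {P : Set} (p? : Dec P) → (P → ⊥) → ⌊ p? ⌋ ≡ false
  isYes-false p? ¬p = trans (isYes≗does p?) (dec-false p? ¬p)

  isYes-⇔ : ∀ {P Q : Set} → (P → Q) → (Q → P) → (p? : Dec P) (q? : Dec Q) → ⌊ p? ⌋ ≡ ⌊ q? ⌋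
  isYes-⇔ f g (yes p) q? = sym (isYes-true q? (f p))
  isYes-⇔ f g (no ¬p) q? = sym (isYes-false q? (¬p ∘ g))

  edgeCount : ∀ N → Adj N → (Fin N → Bool) → ℕ
  edgeCount N a P = ∑ N (λ i → ∑ N (λ j → iverson (⌊ i <? j ⌋ ∧ a i j ∧ P i ∧ P j)))

  edgesIn≡edgeCount : ∀ {N} (a : Adj N) P → edgesIn a P ≡ edgeCount N a P
  edgesIn≡edgeCount {N} a P =
    trans (sum-concatMap-tabulate N id _) (∑-cong N (λ i → sum-map-tabulate N id _))

  edgeCount-cong : ∀ N {a a′ : Adj N} {P Q : Fin N → Bool} →
    (∀ i j → a i j ≡ a′ i j) → (∀ i → P i ≡ Q i) → edgeCount N a P ≡ edgeCount N a′ Q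
  edgeCount-cong N a≗a′ P≗Q = ∑-cong N (λ i → ∑-cong N (λ j →
    cong₂ (λ u v → iverson (⌊ i <? j ⌋ ∧ u ∧ v)) (a≗a′ i j) (cong₂ _∧_ (P≗Q i) (P≗Q j))))

  edgeCount-empty : ∀ N (a : Adj N) P → (∀ i j → a i j ≡ false) → edgeCount N a P ≡ 0
  edgeCount-empty N a P a≗false = ∑-zero N (λ i → ∑-zero N (λ j →
    trans (cong (λ u → iverson (⌊ i <? j ⌋ ∧ u ∧ P i ∧ P j)) (a≗false i j))
          (cong iverson (∧-zeroʳ ⌊ i <? j ⌋))))

  <?-↑ˡ↑ˡ : ∀ {m} K (i j : Fin m) → ⌊ i ↑ˡ K <? j ↑ˡ K ⌋ ≡ ⌊ i <? j ⌋
  <?-↑ˡ↑ˡ K i j = isYes-⇔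
    (subst₂ _<_ (toℕ-↑ˡ i K) (toℕ-↑ˡ j K))
    (subst₂ _<_ (sym (toℕ-↑ˡ i K)) (sym (toℕ-↑ˡ j K))) _ _

  <?-↑ʳ↑ʳ : ∀ m {K} (i j : Fin K) → ⌊ m ↑ʳ i <? m ↑ʳ j ⌋ ≡ ⌊ i <? j ⌋
  <?-↑ʳ↑ʳ m i j = isYes-⇔
    (+-cancelˡ-< m _ _ ∘ subst₂ _<_ (toℕ-↑ʳ m i) (toℕ-↑ʳ m j))
    (subst₂ _<_ (sym (toℕ-↑ʳ m i)) (sym (toℕ-↑ʳ m j)) ∘ +-monoʳ-< m) _ _

  <?-↑ˡ↑ʳ : ∀ {m} K (i : Fin m) (j : Fin K) → ⌊ i ↑ˡ K <? m ↑ʳ j ⌋ ≡ true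
  <?-↑ˡ↑ʳ {m} K i j = isYes-true _
    (subst₂ _<_ (sym (toℕ-↑ˡ i K)) (sym (toℕ-↑ʳ m j)) (≤-trans (toℕ<n i) (m≤m+n m (toℕ j))))

  <?-↑ʳ↑ˡ : ∀ {m} K (i : Fin K) (j : Fin m) → ⌊ m ↑ʳ i <? j ↑ˡ K ⌋ ≡ false
  <?-↑ʳ↑ˡ {m} K i j = isYes-false _ (λ i<j → <-irrefl refl (≤-trans (toℕ<n j)
    (≤-trans (m≤m+n m (toℕ i)) (<⇒≤ (subst₂ _<_ (toℕ-↑ʳ m i) (toℕ-↑ˡ j K) i<j)))))

  edgeCount-↑ : ∀ m K (a : Adj (m + K)) (P : Fin (m + K) → Bool) →
    edgeCount (m + K) a P ≡
      (edgeCount m (λ i j → a (i ↑ˡ K) (j ↑ˡ K)) (P ∘ (_↑ˡ K))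
       + ∑ m (λ i → ∑ K (λ j → iverson (a (i ↑ˡ K) (m ↑ʳ j) ∧ P (i ↑ˡ K) ∧ P (m ↑ʳ j)))))
      + edgeCount K (λ i j → a (m ↑ʳ i) (m ↑ʳ j)) (P ∘ (m ↑ʳ_))
  edgeCount-↑ m K a P = begin
    edgeCount (m + K) a P
      ≡⟨ ∑-↑ m K _ ⟩
    ∑ m (λ i → ∑ (m + K) (e (i ↑ˡ K))) + ∑ K (λ i → ∑ (m + K) (e (m ↑ʳ i)))
      ≡⟨ cong₂ _+_ (∑-cong m (λ i → ∑-↑ m K (e (i ↑ˡ K)))) (∑-cong K (λ i → ∑-↑ m K (e (m ↑ʳ i)))) ⟩
    ∑ m (λ i → ∑ m (λ j → e (i ↑ˡ K) (j ↑ˡ K)) + ∑ K (λ j → e (i ↑ˡ K) (m ↑ʳ j)))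
     + ∑ K (λ i → ∑ m (λ j → e (m ↑ʳ i) (j ↑ˡ K)) + ∑ K (λ j → e (m ↑ʳ i) (m ↑ʳ j)))
      ≡⟨ cong₂ _+_ (∑-+ m _ _) (∑-+ K _ _) ⟩
    (∑ m (λ i → ∑ m (λ j → e (i ↑ˡ K) (j ↑ˡ K))) + ∑ m (λ i → ∑ K (λ j → e (i ↑ˡ K) (m ↑ʳ j))))
     + (∑ K (λ i → ∑ m (λ j → e (m ↑ʳ i) (j ↑ˡ K))) + ∑ K (λ i → ∑ K (λ j → e (m ↑ʳ i) (m ↑ʳ j))))
      ≡⟨ cong₂ _+_
           (cong₂ _+_ (∑-cong m (λ i → ∑-cong m (λ j → ∧-congʳ (<?-↑ˡ↑ˡ K i j))))
                      (∑-cong m (λ i → ∑-cong K (λ j → ∧-congʳ (<?-↑ˡ↑ʳ K i j)))))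
           (cong₂ _+_ (∑-zero K (λ i → ∑-zero m (λ j → ∧-congʳ (<?-↑ʳ↑ˡ K i j))))
                      (∑-cong K (λ i → ∑-cong K (λ j → ∧-congʳ (<?-↑ʳ↑ʳ m i j))))) ⟩
    _ ∎
    where
    open ≡-Reasoning
    e : Fin (m + K) → Fin (m + K) → ℕ
    e i j = iverson (⌊ i <? j ⌋ ∧ a i j ∧ P i ∧ P j)
    ∧-congʳ : ∀ {x y r : Bool} → x ≡ y → iverson (x ∧ r) ≡ iverson (y ∧ r)
    ∧-congʳ refl = refl

  edgeCount-suc : ∀ N (a : Adj (suc N)) (P : Fin (suc N) → Bool) →
    edgeCount (suc N) a P ≡
      ∑ N (λ j → iverson (a zero (suc j) ∧ P zero ∧ P (suc j)))
      + edgeCount N (λ i j → a (suc i) (suc j)) (P ∘ suc)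
  edgeCount-suc N a P =
    trans (edgeCount-↑ 1 N a P)
          (cong (_+ edgeCount N (λ i j → a (suc i) (suc j)) (P ∘ suc)) (+-identityʳ _))

  edgeCount-star : ∀ h (P : Fin (suc h) → Bool) →
    edgeCount (suc h) (starAdj h) P ≡ ∑ h (λ j → iverson (P zero ∧ P (suc j)))
  edgeCount-star h P = trans (edgeCount-suc h (starAdj h) P)
    (trans (cong (∑ h (λ j → iverson (P zero ∧ P (suc j))) +_)
                  (edgeCount-empty h (λ _ _ → false) (P ∘ suc) (λ _ _ → refl)))
           (+-identityʳ _))

  cent : ∀ H → Fin (size H)
  cent []      = zero
  cent (h ∷ H) = suc h ↑ʳ cent H

  module _ (h : ℕ) (H : List ℕ) where

    SHAdj-↑ˡ↑ˡ : ∀ i j → SHAdj (h ∷ H) (i ↑ˡ size H) (j ↑ˡ size H) ≡ starAdj h i j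
    SHAdj-↑ˡ↑ˡ i j rewrite splitAt-↑ˡ (suc h) i (size H) | splitAt-↑ˡ (suc h) j (size H) = refl

    SHAdj-↑ˡ↑ʳ : ∀ i j → SHAdj (h ∷ H) (i ↑ˡ size H) (suc h ↑ʳ j) ≡ (⌊ i ≟ zero ⌋ ∧ isCent H j)
    SHAdj-↑ˡ↑ʳ i j rewrite splitAt-↑ˡ (suc h) i (size H) | splitAt-↑ʳ (suc h) (size H) j = refl

    SHAdj-↑ʳ↑ʳ : ∀ i j → SHAdj (h ∷ H) (suc h ↑ʳ i) (suc h ↑ʳ j) ≡ SHAdj H i j
    SHAdj-↑ʳ↑ʳ i j rewrite splitAt-↑ʳ (suc h) (size H) i | splitAt-↑ʳ (suc h) (size H) j = refl

    isCent-↑ˡ : ∀ i → isCent (h ∷ H) (i ↑ˡ size H) ≡ false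
    isCent-↑ˡ i rewrite splitAt-↑ˡ (suc h) i (size H) = refl

    isCent-↑ʳ : ∀ j → isCent (h ∷ H) (suc h ↑ʳ j) ≡ isCent H j
    isCent-↑ʳ j rewrite splitAt-↑ʳ (suc h) (size H) j = refl

  ∑-isCent : ∀ H (X : Fin (size H) → Bool) → ∑ (size H) (λ j → iverson (isCent H j ∧ X j)) ≡ iverson (X (cent H))
  ∑-isCent []      X = +-identityʳ _
  ∑-isCent (h ∷ H) X = trans (∑-↑ (suc h) (size H) (λ j → iverson (isCent (h ∷ H) j ∧ X j)))
    (cong₂ _+_ (∑-zero (suc h) (λ i → cong (λ c → iverson (c ∧ X (i ↑ˡ size H))) (isCent-↑ˡ h H i)))
               (trans (∑-cong (size H) (λ j → cong (λ c → iverson (c ∧ X (suc h ↑ʳ j))) (isCent-↑ʳ h H j)))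
                      (∑-isCent H (X ∘ (suc h ↑ʳ_)))))

  -- The only edge between the star S_h and the rest of S_{h ∷ H} joins its centre to cent H.
  edgeCount-SH∷ : ∀ h H (P : Fin (size (h ∷ H)) → Bool) →
    edgeCount (size (h ∷ H)) (SHAdj (h ∷ H)) P ≡
      (edgeCount (suc h) (starAdj h) (P ∘ (_↑ˡ size H)) + iverson (P (zero ↑ˡ size H) ∧ P (cent (h ∷ H))))
      + edgeCount (size H) (SHAdj H) (P ∘ (suc h ↑ʳ_))
  edgeCount-SH∷ h H P = trans (edgeCount-↑ (suc h) (size H) (SHAdj (h ∷ H)) P)
    (cong₂ _+_ (cong₂ _+_ (edgeCount-cong (suc h) {P = P ∘ L} (SHAdj-↑ˡ↑ˡ h H) (λ _ → refl)) crossing)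
               (edgeCount-cong (size H) {P = P ∘ R} (SHAdj-↑ʳ↑ʳ h H) (λ _ → refl)))
    where
    open ≡-Reasoning
    L : Fin (suc h) → Fin (size (h ∷ H))
    L i = i ↑ˡ size H
    R : Fin (size H) → Fin (size (h ∷ H))
    R j = suc h ↑ʳ j
    crossing : ∑ (suc h) (λ i → ∑ (size H) (λ j → iverson (SHAdj (h ∷ H) (L i) (R j) ∧ P (L i) ∧ P (R j))))
               ≡ iverson (P (L zero) ∧ P (R (cent H)))
    crossing = begin
      ∑ (suc h) (λ i → ∑ (size H) (λ j → iverson (SHAdj (h ∷ H) (L i) (R j) ∧ P (L i) ∧ P (R j))))
        ≡⟨ ∑-cong (suc h) (λ i → ∑-cong (size H) (λ j →
             cong (λ c → iverson (c ∧ P (L i) ∧ P (R j))) (SHAdj-↑ˡ↑ʳ h H i j))) ⟩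
      ∑ (suc h) (λ i → ∑ (size H) (λ j → iverson ((⌊ i ≟ zero ⌋ ∧ isCent H j) ∧ P (L i) ∧ P (R j))))
        ≡⟨ cong₂ _+_ (∑-isCent H (λ j → P (L zero) ∧ P (R j)))
                     (∑-zero h (λ i → ∑-zero (size H) (λ j →
                        cong (λ c → iverson ((c ∧ isCent H j) ∧ P (L (suc i)) ∧ P (R j)))
                             (isYes-false (suc i ≟ zero) (λ ()))))) ⟩
      iverson (P (L zero) ∧ P (R (cent H))) + 0
        ≡⟨ +-identityʳ _ ⟩
      iverson (P (L zero) ∧ P (R (cent H))) ∎

  combine-ind : ∀ {n} k {Q : Fin (n * k) → Set} → (∀ v a → Q (combine v a)) → ∀ x → Q x
  combine-ind {n} k {Q} q x =
    subst Q (combine-remQuot {n} k x) (q (proj₁ (remQuot {n} k x)) (proj₂ (remQuot {n} k x)))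

  module _ (H : List ℕ) where

    rootedAdj-combine : ∀ {n} (g : Adj n) v w a b →
      rootedAdj g H (combine v a) (combine w b) ≡ (⌊ v ≟ w ⌋ ∧ SHAdj H a b) ∨ (isCent H a ∧ isCent H b ∧ g v w)
    rootedAdj-combine g v w a b =
      cong₂ (λ { (v , a) (w , b) → (⌊ v ≟ w ⌋ ∧ SHAdj H a b) ∨ (isCent H a ∧ isCent H b ∧ g v w) })
            (remQuot-combine {k = size H} v a) (remQuot-combine {k = size H} w b)

    rootedAdj-diag : ∀ {n} (g : Adj n) v → g v v ≡ false →
      ∀ a b → rootedAdj g H (combine v a) (combine v b) ≡ SHAdj H a b
    rootedAdj-diag g v gvv≡false a b
      rewrite rootedAdj-combine g v v a b | isYes-true (v ≟ v) refl | gvv≡false =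
      trans (cong (SHAdj H a b ∨_) (trans (cong (isCent H a ∧_) (∧-zeroʳ (isCent H b))) (∧-zeroʳ (isCent H a))))
            (∨-identityʳ _)

    rootedAdj-↑ʳ : ∀ {n} (g : Adj (suc n)) (x y : Fin (n * size H)) →
      rootedAdj g H (size H ↑ʳ x) (size H ↑ʳ y) ≡ rootedAdj (λ v w → g (suc v) (suc w)) H x y
    rootedAdj-↑ʳ {n} g = combine-ind (size H) {Q = λ x → ∀ y → Goal x y} λ v a →
                         combine-ind (size H) {Q = Goal (combine v a)} λ w b →
      trans (rootedAdj-combine g (suc v) (suc w) a b)
        (trans (cong (λ c → (c ∧ SHAdj H a b) ∨ (isCent H a ∧ isCent H b ∧ g (suc v) (suc w)))
                     (isYes-⇔ suc-injective (cong suc) _ _))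
               (sym (rootedAdj-combine (λ v w → g (suc v) (suc w)) v w a b)))
      where
      Goal : Fin (n * size H) → Fin (n * size H) → Set
      Goal x y = rootedAdj g H (size H ↑ʳ x) (size H ↑ʳ y) ≡ rootedAdj (λ v w → g (suc v) (suc w)) H x y

    crossEdges-rooted : ∀ {n} (g : Adj (suc n)) (P : Fin (suc n * size H) → Bool) →
      ∑ (size H) (λ a → ∑ (n * size H) (λ x →
        iverson (rootedAdj g H (combine {suc n} zero a) (size H ↑ʳ x) ∧ P (combine {suc n} zero a) ∧ P (size H ↑ʳ x))))
      ≡ ∑ n (λ v → iverson (g zero (suc v) ∧ P (combine {suc n} zero (cent H)) ∧ P (combine (suc v) (cent H))))
    crossEdges-rooted {n} g P = begin
      ∑ m (λ a → ∑ (n * m) (λ x → iverson (rootedAdj g H (c₀ a) (m ↑ʳ x) ∧ P (c₀ a) ∧ P (m ↑ʳ x))))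
        ≡⟨ ∑-cong m (λ a → ∑-combine n m _) ⟩
      ∑ m (λ a → ∑ n (λ v → ∑ m (λ b →
        iverson (rootedAdj g H (c₀ a) (combine (suc v) b) ∧ P (c₀ a) ∧ P (combine (suc v) b)))))
        ≡⟨ ∑-cong m (λ a → ∑-cong n (λ v → ∑-cong m (λ b → adjacency a v b))) ⟩
      ∑ m (λ a → ∑ n (λ v → ∑ m (λ b →
        iverson (isCent H b ∧ isCent H a ∧ g zero (suc v) ∧ P (c₀ a) ∧ P (combine (suc v) b)))))
        ≡⟨ ∑-cong m (λ a → ∑-cong n (λ v → ∑-isCent H _)) ⟩
      ∑ m (λ a → ∑ n (λ v → iverson (isCent H a ∧ g zero (suc v) ∧ P (c₀ a) ∧ P (combine (suc v) (cent H)))))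
        ≡⟨ ∑-swap m n _ ⟩
      ∑ n (λ v → ∑ m (λ a → iverson (isCent H a ∧ g zero (suc v) ∧ P (c₀ a) ∧ P (combine (suc v) (cent H)))))
        ≡⟨ ∑-cong n (λ v → ∑-isCent H _) ⟩
      ∑ n (λ v → iverson (g zero (suc v) ∧ P (c₀ (cent H)) ∧ P (combine (suc v) (cent H)))) ∎
      where
      open ≡-Reasoning
      m = size H
      c₀ : Fin m → Fin (suc n * m)
      c₀ = combine {suc n} zero
      ∧-rearrange : ∀ x y z w → ((x ∧ y ∧ z) ∧ w) ≡ (y ∧ x ∧ z ∧ w)
      ∧-rearrange true  y z w = ∧-assoc y z w
      ∧-rearrange false y z w = sym (∧-zeroʳ y)
      adjacency : ∀ a v b →
        iverson (rootedAdj g H (c₀ a) (combine (suc v) b) ∧ P (c₀ a) ∧ P (combine (suc v) b))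
        ≡ iverson (isCent H b ∧ isCent H a ∧ g zero (suc v) ∧ P (c₀ a) ∧ P (combine (suc v) b))
      adjacency a v b = cong iverson (trans
        (cong (_∧ (P (c₀ a) ∧ P (combine (suc v) b)))
              (trans (rootedAdj-combine g zero (suc v) a b)
                     (cong (λ c → (c ∧ SHAdj H a b) ∨ (isCent H a ∧ isCent H b ∧ g zero (suc v)))
                           (isYes-false (zero ≟ suc v) (λ ())))))
        (∧-rearrange (isCent H a) (isCent H b) (g zero (suc v)) _))

    edgeCount-rooted : ∀ n (g : Adj n) → (∀ v → g v v ≡ false) → (P : Fin (n * size H) → Bool) →
      edgeCount (n * size H) (rootedAdj g H) P ≡
        ∑ n (λ v → edgeCount (size H) (SHAdj H) (P ∘ combine v)) + edgeCount n g (λ v → P (combine v (cent H)))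
    edgeCount-rooted zero    g irr P = refl
    edgeCount-rooted (suc n) g irr P = begin
      edgeCount (suc n * m) (rootedAdj g H) P
        ≡⟨ edgeCount-↑ m (n * m) (rootedAdj g H) P ⟩
      (edgeCount m (λ a b → rootedAdj g H (c₀ a) (c₀ b)) (P ∘ c₀) + crossing)
        + edgeCount (n * m) (λ x y → rootedAdj g H (m ↑ʳ x) (m ↑ʳ y)) (P ∘ (m ↑ʳ_))
        ≡⟨ cong₂ _+_
             (cong₂ _+_ (edgeCount-cong m {P = P ∘ c₀} (rootedAdj-diag g zero (irr zero)) (λ _ → refl))
                        (crossEdges-rooted g P))
             (trans (edgeCount-cong (n * m) {P = P ∘ (m ↑ʳ_)} (rootedAdj-↑ʳ g) (λ _ → refl))
                    (edgeCount-rooted n g′ (irr ∘ suc) (P ∘ (m ↑ʳ_)))) ⟩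
      (copy zero + centreEdges) + (∑ n (copy ∘ suc) + edgeCount n g′ (r ∘ suc))
        ≡⟨ interchange (copy zero) centreEdges (∑ n (copy ∘ suc)) (edgeCount n g′ (r ∘ suc)) ⟩
      ∑ (suc n) copy + (centreEdges + edgeCount n g′ (r ∘ suc))
        ≡⟨ cong (∑ (suc n) copy +_) (sym (edgeCount-suc n g r)) ⟩
      ∑ (suc n) copy + edgeCount (suc n) g r ∎
      where
      open ≡-Reasoning
      m = size H
      c₀ : Fin m → Fin (suc n * m)
      c₀ = combine {suc n} zero
      g′ : Adj n
      g′ v w = g (suc v) (suc w)
      r : Fin (suc n) → Bool
      r v = P (combine v (cent H))
      copy : Fin (suc n) → ℕ
      copy v = edgeCount m (SHAdj H) (P ∘ combine v)
      crossing = ∑ m (λ a → ∑ (n * m) (λ x → iverson (rootedAdj g H (c₀ a) (m ↑ʳ x) ∧ P (c₀ a) ∧ P (m ↑ʳ x))))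
      centreEdges = ∑ n (λ v → iverson (g zero (suc v) ∧ r zero ∧ r (suc v)))

  monoEdges : ∀ N → Adj N → (Fin N → Bool) → ℕ
  monoEdges N a P = edgeCount N a P + edgeCount N a (not ∘ P)

  agree : Bool → Bool → ℕ
  agree x c = iverson (x ∧ c) + iverson (not x ∧ not c)

  monoEdges-cong : ∀ N (a : Adj N) {P Q : Fin N → Bool} → (∀ i → P i ≡ Q i) → monoEdges N a P ≡ monoEdges N a Q
  monoEdges-cong N a P≗Q =
    cong₂ _+_ (edgeCount-cong N {a} (λ _ _ → refl) P≗Q) (edgeCount-cong N {a} (λ _ _ → refl) (cong not ∘ P≗Q))

  monoEdges-star : ∀ h (P : Fin (suc h) → Bool) →
    monoEdges (suc h) (starAdj h) P ≡ ∑ h (λ j → agree (P zero) (P (suc j)))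
  monoEdges-star h P = trans (cong₂ _+_ (edgeCount-star h P) (edgeCount-star h (not ∘ P))) (sym (∑-+ h _ _))

  monoEdges-SH∷ : ∀ h H (P : Fin (size (h ∷ H)) → Bool) →
    monoEdges (size (h ∷ H)) (SHAdj (h ∷ H)) P ≡
      (monoEdges (suc h) (starAdj h) (P ∘ (_↑ˡ size H)) + agree (P (zero ↑ˡ size H)) (P (cent (h ∷ H))))
      + monoEdges (size H) (SHAdj H) (P ∘ (suc h ↑ʳ_))
  monoEdges-SH∷ h H P = trans (cong₂ _+_ (edgeCount-SH∷ h H P) (edgeCount-SH∷ h H (not ∘ P)))
    (trans (interchange (edgeCount (suc h) (starAdj h) (P ∘ (_↑ˡ size H)) + iverson (P (zero ↑ˡ size H) ∧ P (cent (h ∷ H)))) _ _ _)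
           (cong (_+ monoEdges (size H) (SHAdj H) (P ∘ (suc h ↑ʳ_)))
                 (interchange (edgeCount (suc h) (starAdj h) (P ∘ (_↑ˡ size H))) _ _ _)))

  monoEdges-rooted : ∀ H n (g : Adj n) → (∀ v → g v v ≡ false) → (P : Fin (n * size H) → Bool) →
    monoEdges (n * size H) (rootedAdj g H) P ≡
      ∑ n (λ v → monoEdges (size H) (SHAdj H) (P ∘ combine v)) + monoEdges n g (λ v → P (combine v (cent H)))
  monoEdges-rooted H n g irr P =
    trans (cong₂ _+_ (edgeCount-rooted H n g irr P) (edgeCount-rooted H n g irr (not ∘ P)))
      (trans (interchange (∑ n (λ v → edgeCount (size H) (SHAdj H) (P ∘ combine v))) _ _ _)
             (cong (_+ monoEdges n g (λ v → P (combine v (cent H)))) (sym (∑-+ n _ _))))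

  ∣∷∣ : ∀ {N} x (S : Subset N) → ∣ x ∷ S ∣ ≡ iverson x + ∣ S ∣
  ∣∷∣ true  S = refl
  ∣∷∣ false S = refl

  ∣S∣≡∑ : ∀ N (S : Subset N) → ∣ S ∣ ≡ ∑ N (iverson ∘ lookup S)
  ∣S∣≡∑ zero    []      = refl
  ∣S∣≡∑ (suc N) (x ∷ S) = trans (∣∷∣ x S) (cong (iverson x +_) (∣S∣≡∑ N S))

  ∣++∣ : ∀ {m K} (S : Subset m) (T : Subset K) → ∣ S ++ T ∣ ≡ ∣ S ∣ + ∣ T ∣
  ∣++∣ []      T = refl
  ∣++∣ (x ∷ S) T = begin
    ∣ x ∷ (S ++ T) ∣         ≡⟨ ∣∷∣ x (S ++ T) ⟩
    iverson x + ∣ S ++ T ∣   ≡⟨ cong (iverson x +_) (∣++∣ S T) ⟩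
    iverson x + (∣ S ∣ + ∣ T ∣) ≡⟨ sym (+-assoc (iverson x) _ _) ⟩
    (iverson x + ∣ S ∣) + ∣ T ∣ ≡⟨ cong (_+ ∣ T ∣) (sym (∣∷∣ x S)) ⟩
    ∣ x ∷ S ∣ + ∣ T ∣ ∎
    where open ≡-Reasoning

  block : ∀ {n} m → Subset (n * m) → Fin n → Subset m
  block {n} m S v = tabulate (λ a → lookup S (combine {n} v a))

  block-++-zero : ∀ {n m} (S : Subset m) (T : Subset (n * m)) → block {suc n} m (S ++ T) zero ≡ S
  block-++-zero S T = trans (tabulate-cong (lookup-++ˡ S T)) (tabulate∘lookup S)

  block-++-suc : ∀ {n m} (S : Subset m) (T : Subset (n * m)) v → block {suc n} m (S ++ T) (suc v) ≡ block m T v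
  block-++-suc S T v = tabulate-cong (λ a → lookup-++ʳ S T _)

module RingSums (R : CommutativeRing 0ℓ 0ℓ) where
  open CommutativeRing R hiding (zero)
  open import Relation.Binary.Reasoning.Setoid setoid
  open import Algebra.Solver.Ring.NaturalCoefficients.Default commutativeSemiring
  open import Algebra.Properties.CommutativeSemigroup *-commutativeSemigroup
    using (x∙yz≈y∙xz; xy∙z≈xz∙y) renaming (interchange to *-interchange)
  open import Algebra.Properties.CommutativeSemigroup +-commutativeSemigroup
    using () renaming (interchange to +-interchange)

  infixr 8 _^_
  _^_ : Carrier → ℕ → Carrier
  x ^ k = pow R x k

  ^-cong : ∀ {x y} k → x ≈ y → x ^ k ≈ y ^ k
  ^-cong zero    x≈y = refl
  ^-cong (suc k) x≈y = *-cong x≈y (^-cong k x≈y)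

  ^-+ : ∀ x a b → x ^ (a ℕ.+ b) ≈ x ^ a * x ^ b
  ^-+ x zero    b = sym (*-identityˡ _)
  ^-+ x (suc a) b = trans (*-congˡ (^-+ x a b)) (sym (*-assoc _ _ _))

  ∏ : ∀ N → (Fin N → Carrier) → Carrier
  ∏ zero    f = 1#
  ∏ (suc N) f = f zero * ∏ N (f ∘ suc)

  ∏-cong : ∀ N {f g : Fin N → Carrier} → (∀ i → f i ≈ g i) → ∏ N f ≈ ∏ N g
  ∏-cong zero    f≈g = refl
  ∏-cong (suc N) f≈g = *-cong (f≈g zero) (∏-cong N (f≈g ∘ suc))

  ∏-* : ∀ N (f g : Fin N → Carrier) → ∏ N (λ i → f i * g i) ≈ ∏ N f * ∏ N g
  ∏-* zero    f g = sym (*-identityˡ _)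
  ∏-* (suc N) f g = trans (*-congˡ (∏-* N (f ∘ suc) (g ∘ suc)))
    (*-interchange (f zero) (g zero) _ _)

  ^-∑ : ∀ x N (f : Fin N → ℕ) → x ^ ∑ N f ≈ ∏ N (λ i → x ^ f i)
  ^-∑ x zero    f = refl
  ^-∑ x (suc N) f = trans (^-+ x (f zero) _) (*-congˡ (^-∑ x N (f ∘ suc)))

  ∑ₗ : {A : Set} → List A → (A → Carrier) → Carrier
  ∑ₗ L F = Σ-list R (map F L)

  module _ {A : Set} where

    ∑ₗ-cong : ∀ (L : List A) {F G : A → Carrier} → (∀ S → F S ≈ G S) → ∑ₗ L F ≈ ∑ₗ L G
    ∑ₗ-cong []      F≈G = refl
    ∑ₗ-cong (S ∷ L) F≈G = +-cong (F≈G S) (∑ₗ-cong L F≈G)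

    ∑ₗ-+ : ∀ (L : List A) (F G : A → Carrier) → ∑ₗ L (λ S → F S + G S) ≈ ∑ₗ L F + ∑ₗ L G
    ∑ₗ-+ []      F G = sym (+-identityˡ _)
    ∑ₗ-+ (S ∷ L) F G = trans (+-congˡ (∑ₗ-+ L F G))
      (+-interchange (F S) (G S) _ _)

    ∑ₗ-*ˡ : ∀ (L : List A) c (F : A → Carrier) → ∑ₗ L (λ S → c * F S) ≈ c * ∑ₗ L F
    ∑ₗ-*ˡ []      c F = sym (zeroʳ c)
    ∑ₗ-*ˡ (S ∷ L) c F = trans (+-congˡ (∑ₗ-*ˡ L c F)) (sym (distribˡ c _ _))

    ∑ₗ-*ʳ : ∀ (L : List A) c (F : A → Carrier) → ∑ₗ L (λ S → F S * c) ≈ ∑ₗ L F * c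
    ∑ₗ-*ʳ L c F = trans (∑ₗ-cong L (λ S → *-comm (F S) c)) (trans (∑ₗ-*ˡ L c F) (*-comm c _))

  ∑ₛ : ∀ N → (Subset N → Carrier) → Carrier
  ∑ₛ N = ∑ₗ (allSubsets N)

  ∑ₛ-suc : ∀ N (F : Subset (suc N) → Carrier) → ∑ₛ (suc N) F ≈ ∑ₛ N (λ S → F (true ∷ S) + F (false ∷ S))
  ∑ₛ-suc N F = go (allSubsets N)
    where
    go : ∀ L → ∑ₗ (concatMap (λ S → (true ∷ S) ∷ (false ∷ S) ∷ []) L) F ≈ ∑ₗ L (λ S → F (true ∷ S) + F (false ∷ S))
    go []      = refl
    go (S ∷ L) = trans (+-congˡ (+-congˡ (go L))) (sym (+-assoc _ _ _))

  ∑ₛ-++ : ∀ m K (F : Subset (m ℕ.+ K) → Carrier) → ∑ₛ (m ℕ.+ K) F ≈ ∑ₛ m (λ S → ∑ₛ K (λ T → F (S ++ T)))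
  ∑ₛ-++ zero    K F = sym (+-identityʳ _)
  ∑ₛ-++ (suc m) K F = begin
    ∑ₛ (suc (m ℕ.+ K)) F
      ≈⟨ ∑ₛ-suc (m ℕ.+ K) F ⟩
    ∑ₛ (m ℕ.+ K) (λ S → F (true ∷ S) + F (false ∷ S))
      ≈⟨ ∑ₛ-++ m K _ ⟩
    ∑ₛ m (λ S → ∑ₛ K (λ T → F (true ∷ (S ++ T)) + F (false ∷ (S ++ T))))
      ≈⟨ ∑ₗ-cong (allSubsets m) (λ S → ∑ₗ-+ (allSubsets K) _ _) ⟩
    ∑ₛ m (λ S → ∑ₛ K (λ T → F (true ∷ (S ++ T))) + ∑ₛ K (λ T → F (false ∷ (S ++ T))))
      ≈⟨ sym (∑ₛ-suc m _) ⟩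
    ∑ₛ (suc m) (λ S → ∑ₛ K (λ T → F (S ++ T))) ∎

  ∑ₛ-∏ : ∀ N (f : Bool → Carrier) → ∑ₛ N (λ S → ∏ N (f ∘ lookup S)) ≈ (f true + f false) ^ N
  ∑ₛ-∏ zero    f = +-identityʳ _
  ∑ₛ-∏ (suc N) f = begin
    ∑ₛ (suc N) (λ S → ∏ (suc N) (f ∘ lookup S))
      ≈⟨ ∑ₛ-suc N _ ⟩
    ∑ₛ N (λ S → f true * ∏ N (f ∘ lookup S) + f false * ∏ N (f ∘ lookup S))
      ≈⟨ trans (∑ₗ-+ (allSubsets N) _ _) (+-cong (∑ₗ-*ˡ (allSubsets N) _ _) (∑ₗ-*ˡ (allSubsets N) _ _)) ⟩
    f true * ∑ₛ N (λ S → ∏ N (f ∘ lookup S)) + f false * ∑ₛ N (λ S → ∏ N (f ∘ lookup S))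
      ≈⟨ +-cong (*-congˡ (∑ₛ-∏ N f)) (*-congˡ (∑ₛ-∏ N f)) ⟩
    f true * (f true + f false) ^ N + f false * (f true + f false) ^ N
      ≈⟨ sym (distribʳ _ _ _) ⟩
    (f true + f false) ^ suc N ∎

  select : Bool → Bool → Carrier → Carrier
  select true  true  x = x
  select false false x = x
  select _     _     _ = 0#

  select-cong : ∀ b c {x x′} → x ≈ x′ → select b c x ≈ select b c x′
  select-cong true  true  x≈x′ = x≈x′
  select-cong true  false x≈x′ = refl
  select-cong false true  x≈x′ = refl
  select-cong false false x≈x′ = x≈x′

  select-split : ∀ c x (Y : Bool → Carrier) → x * Y c ≈ select true c x * Y true + select false c x * Y false
  select-split true  x Y = sym (trans (+-congˡ (zeroˡ _)) (+-identityʳ _))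
  select-split false x Y = sym (trans (+-congʳ (zeroˡ _)) (+-identityˡ _))

  select-factor : ∀ b c (X : Bool → Carrier) z → select b c (X c * z) ≈ X b * select b c z
  select-factor true  true  X z = refl
  select-factor true  false X z = sym (zeroʳ _)
  select-factor false true  X z = sym (zeroʳ _)
  select-factor false false X z = refl

  module _ {m : ℕ} (A : Subset m → Carrier) (f : Subset m → Bool) where

    fibreSum : Bool → Carrier
    fibreSum b = ∑ₛ m (λ s → select b (f s) (A s))

    -- Fin (n * m) is read as n blocks of size m: once the f-value of every block is fixed,
    -- the sum over S splits into independent sums over the blocks.
    ∑ₛ-blocks : ∀ n (B : Subset n → Carrier) →
      ∑ₛ (n ℕ.* m) (λ S → ∏ n (A ∘ block m S) * B (tabulate (f ∘ block m S)))
      ≈ ∑ₛ n (λ r → B r * ∏ n (fibreSum ∘ lookup r))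
    ∑ₛ-blocks zero    B = +-congʳ (trans (*-identityˡ _) (sym (*-identityʳ _)))
    ∑ₛ-blocks (suc n) B = begin
      ∑ₛ (suc n ℕ.* m) (λ S → ∏ (suc n) (A ∘ block m S) * B (tabulate (f ∘ block m S)))
        ≈⟨ ∑ₛ-++ m (n ℕ.* m) _ ⟩
      ∑ₛ m (λ S → ∑ₛ (n ℕ.* m) (λ T → ∏ (suc n) (A ∘ block m (S ++ T)) * B (tabulate (f ∘ block m (S ++ T)))))
        ≈⟨ ∑ₗ-cong (allSubsets m) (λ S → ∑ₗ-cong (allSubsets (n ℕ.* m)) (peel S)) ⟩
      ∑ₛ m (λ S → ∑ₛ (n ℕ.* m) (λ T → A S * (∏ n (A ∘ block m T) * B (f S ∷ tabulate (f ∘ block m T)))))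
        ≈⟨ ∑ₗ-cong (allSubsets m) (λ S → trans (∑ₗ-*ˡ (allSubsets (n ℕ.* m)) _ _)
                                               (*-congˡ (∑ₛ-blocks n (B ∘ (f S ∷_))))) ⟩
      ∑ₛ m (λ S → A S * Y (f S))
        ≈⟨ ∑ₗ-cong (allSubsets m) (λ S → select-split (f S) (A S) Y) ⟩
      ∑ₛ m (λ S → select true (f S) (A S) * Y true + select false (f S) (A S) * Y false)
        ≈⟨ trans (∑ₗ-+ (allSubsets m) _ _) (+-cong (∑ₗ-*ʳ (allSubsets m) _ _) (∑ₗ-*ʳ (allSubsets m) _ _)) ⟩
      fibreSum true * Y true + fibreSum false * Y false
        ≈⟨ sym (+-cong (pull true) (pull false)) ⟩
      ∑ₛ n (λ r → B (true ∷ r) * (fibreSum true * Π r)) + ∑ₛ n (λ r → B (false ∷ r) * (fibreSum false * Π r))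
        ≈⟨ sym (trans (∑ₛ-suc n _) (∑ₗ-+ (allSubsets n) _ _)) ⟩
      ∑ₛ (suc n) (λ r → B r * ∏ (suc n) (fibreSum ∘ lookup r)) ∎
      where
      Π : Subset n → Carrier
      Π r = ∏ n (fibreSum ∘ lookup r)
      Y : Bool → Carrier
      Y b = ∑ₛ n (λ r → B (b ∷ r) * Π r)
      pull : ∀ b → ∑ₛ n (λ r → B (b ∷ r) * (fibreSum b * Π r)) ≈ fibreSum b * Y b
      pull b = trans (∑ₗ-cong (allSubsets n) (λ r → x∙yz≈y∙xz (B (b ∷ r)) (fibreSum b) (Π r)))
                     (∑ₗ-*ˡ (allSubsets n) _ _)
      peel : ∀ S T → ∏ (suc n) (A ∘ block m (S ++ T)) * B (tabulate (f ∘ block m (S ++ T)))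
                     ≈ A S * (∏ n (A ∘ block m T) * B (f S ∷ tabulate (f ∘ block m T)))
      peel S T = trans
        (*-cong (*-cong (reflexive (≡.cong A (block-++-zero {n} S T)))
                        (∏-cong n (λ v → reflexive (≡.cong A (block-++-suc {n} S T v)))))
                (reflexive (≡.cong B (≡.cong₂ _∷_ (≡.cong f (block-++-zero {n} S T))
                                                 (tabulate-cong (λ v → ≡.cong f (block-++-suc {n} S T v)))))))
        (*-assoc _ _ _)

  ∏-lookup : (F : Bool → Carrier) {d q : Carrier} → F true ≈ d * q → F false ≈ d →
    ∀ {k} (r : Subset k) → ∏ k (F ∘ lookup r) ≈ d ^ k * q ^ ∣ r ∣
  ∏-lookup F Ft Ff []          = sym (*-identityˡ _)
  ∏-lookup F Ft Ff (true ∷ r)  = trans (*-cong Ft (∏-lookup F Ft Ff r)) (*-interchange _ _ _ _)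
  ∏-lookup F Ft Ff (false ∷ r) = trans (*-cong Ff (∏-lookup F Ft Ff r)) (sym (*-assoc _ _ _))

  module _ (t y : Carrier) where

    weight : ∀ {N} → Adj N → Subset N → Carrier
    weight {N} a S = t ^ monoEdges N a (lookup S) * y ^ ∣ S ∣

    Z≈∑ₛweight : ∀ {N} (a : Adj N) → Z R a t y ≈ ∑ₛ N (weight a)
    Z≈∑ₛweight {N} a = ∑ₗ-cong (allSubsets N) (λ S → reflexive (≡.cong (λ k → t ^ k * y ^ ∣ S ∣)
      (≡.cong₂ ℕ._+_ (edgesIn≡edgeCount a (lookup S)) (edgesIn≡edgeCount a (not ∘ lookup S)))))

    leafWeight : Bool → Bool → Carrier
    leafWeight x c = t ^ agree x c * y ^ iverson c

    weight-star : ∀ h x S → weight (starAdj h) (x ∷ S) ≈ y ^ iverson x * ∏ h (leafWeight x ∘ lookup S)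
    weight-star h x S = begin
      t ^ monoEdges (suc h) (starAdj h) (lookup (x ∷ S)) * y ^ ∣ x ∷ S ∣
        ≈⟨ *-cong (reflexive (≡.cong (t ^_) (monoEdges-star h (lookup (x ∷ S)))))
                  (reflexive (≡.cong (y ^_) (≡.trans (∣∷∣ x S) (≡.cong (iverson x ℕ.+_) (∣S∣≡∑ h S))))) ⟩
      t ^ ∑ h (agree x ∘ lookup S) * y ^ (iverson x ℕ.+ ∑ h (iverson ∘ lookup S))
        ≈⟨ *-cong (^-∑ t h (agree x ∘ lookup S)) (trans (^-+ y (iverson x) _) (*-congˡ (^-∑ y h (iverson ∘ lookup S)))) ⟩
      ∏ h (λ j → t ^ agree x (lookup S j)) * (y ^ iverson x * ∏ h (λ j → y ^ iverson (lookup S j)))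
        ≈⟨ x∙yz≈y∙xz _ _ _ ⟩
      y ^ iverson x * (∏ h (λ j → t ^ agree x (lookup S j)) * ∏ h (λ j → y ^ iverson (lookup S j)))
        ≈⟨ *-congˡ (sym (∏-* h _ _)) ⟩
      y ^ iverson x * ∏ h (leafWeight x ∘ lookup S) ∎

    ∑ₛ-weight-star : ∀ h x → ∑ₛ h (weight (starAdj h) ∘ (x ∷_)) ≈ y ^ iverson x * (leafWeight x true + leafWeight x false) ^ h
    ∑ₛ-weight-star h x = trans (∑ₗ-cong (allSubsets h) (weight-star h x))
      (trans (∑ₗ-*ˡ (allSubsets h) _ _) (*-congˡ (∑ₛ-∏ h (leafWeight x))))

    -- Weight of the star S_h together with its edge to a centre of colour b.
    starSum : ℕ → Bool → Carrier
    starSum h b = ∑ₛ (suc h) (λ S → weight (starAdj h) S * t ^ agree (lookup S zero) b)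

    starSum-eval : ∀ h b → starSum h b ≈ (y * (y * t + 1#) ^ h) * t ^ agree true b + (y + t) ^ h * t ^ agree false b
    starSum-eval h b = begin
      starSum h b
        ≈⟨ trans (∑ₛ-suc h _) (∑ₗ-+ (allSubsets h) _ _) ⟩
      ∑ₛ h (λ S → weight (starAdj h) (true ∷ S) * t ^ agree true b)
        + ∑ₛ h (λ S → weight (starAdj h) (false ∷ S) * t ^ agree false b)
        ≈⟨ +-cong (trans (∑ₗ-*ʳ (allSubsets h) _ _) (*-congʳ (∑ₛ-weight-star h true)))
                  (trans (∑ₗ-*ʳ (allSubsets h) _ _) (*-congʳ (∑ₛ-weight-star h false))) ⟩
      (y * 1# * (leafWeight true true + leafWeight true false) ^ h) * t ^ agree true b
        + (1# * (leafWeight false true + leafWeight false false) ^ h) * t ^ agree false b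
        ≈⟨ +-cong (*-congʳ (*-cong (*-identityʳ y) (^-cong h centreIn)))
                  (*-congʳ (trans (*-identityˡ _) (^-cong h centreOut))) ⟩
      (y * (y * t + 1#) ^ h) * t ^ agree true b + (y + t) ^ h * t ^ agree false b ∎
      where
      centreIn : leafWeight true true + leafWeight true false ≈ y * t + 1#
      centreIn = +-cong (trans (*-cong (*-identityʳ t) (*-identityʳ y)) (*-comm t y)) (*-identityˡ 1#)
      centreOut : leafWeight false true + leafWeight false false ≈ y + t
      centreOut = +-cong (trans (*-identityˡ _) (*-identityʳ y)) (trans (*-identityʳ _) (*-identityʳ t))

    starSum-true : ∀ h → starSum h true ≈ num R t y h
    starSum-true h = trans (starSum-eval h true)
      (solve 4 (λ y t P Q → (y :* P) :* (t :* con 1) :+ Q :* con 1 := y :* t :* P :+ Q) refl y t _ _)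

    starSum-false : ∀ h → starSum h false ≈ den R t y h
    starSum-false h = trans (starSum-eval h false)
      (solve 4 (λ y t P Q → (y :* P) :* con 1 :+ Q :* (t :* con 1) := y :* P :+ t :* Q) refl y t _ _)

    -- Weight of S_H summed over colourings with cent H of colour b (true: cent ∈ S).
    rootedZ : List ℕ → Bool → Carrier
    rootedZ H true  = y * Π-list R (map (num R t y) H)
    rootedZ H false = Π-list R (map (den R t y) H)

    starSum-rootedZ : ∀ h H b → starSum h b * rootedZ H b ≈ rootedZ (h ∷ H) b
    starSum-rootedZ h H true  = trans (*-congʳ (starSum-true h)) (x∙yz≈y∙xz _ _ _)
    starSum-rootedZ h H false = *-congʳ (starSum-false h)

    weight-SH∷ : ∀ h H (S : Subset (suc h)) (T : Subset (size H)) →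
      weight (SHAdj (h ∷ H)) (S ++ T)
      ≈ t ^ agree (lookup S zero) (lookup T (cent H)) * (weight (starAdj h) S * weight (SHAdj H) T)
    weight-SH∷ h H S T = begin
      t ^ monoEdges (size (h ∷ H)) (SHAdj (h ∷ H)) (lookup (S ++ T)) * y ^ ∣ S ++ T ∣
        ≈⟨ reflexive (≡.cong₂ (λ k l → t ^ k * y ^ l) (≡.trans (monoEdges-SH∷ h H (lookup (S ++ T))) edges) (∣++∣ S T)) ⟩
      t ^ ((mS ℕ.+ c) ℕ.+ mT) * y ^ (∣ S ∣ ℕ.+ ∣ T ∣)
        ≈⟨ *-cong (trans (^-+ t (mS ℕ.+ c) mT) (*-congʳ (^-+ t mS c))) (^-+ y ∣ S ∣ ∣ T ∣) ⟩
      ((t ^ mS * t ^ c) * t ^ mT) * (y ^ ∣ S ∣ * y ^ ∣ T ∣)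
        ≈⟨ solve 5 (λ a b c d e → ((a :* b) :* c) :* (d :* e) := b :* ((a :* d) :* (c :* e))) refl _ _ _ _ _ ⟩
      t ^ c * ((t ^ mS * y ^ ∣ S ∣) * (t ^ mT * y ^ ∣ T ∣)) ∎
      where
      mS = monoEdges (suc h) (starAdj h) (lookup S)
      mT = monoEdges (size H) (SHAdj H) (lookup T)
      c = agree (lookup S zero) (lookup T (cent H))
      edges : (monoEdges (suc h) (starAdj h) (lookup (S ++ T) ∘ (_↑ˡ size H))
                 ℕ.+ agree (lookup (S ++ T) (zero ↑ˡ size H)) (lookup (S ++ T) (cent (h ∷ H))))
              ℕ.+ monoEdges (size H) (SHAdj H) (lookup (S ++ T) ∘ (suc h ↑ʳ_))
              ≡ (mS ℕ.+ c) ℕ.+ mT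
      edges = ≡.cong₂ ℕ._+_
        (≡.cong₂ ℕ._+_ (monoEdges-cong (suc h) (starAdj h) (lookup-++ˡ S T))
                       (≡.cong₂ agree (lookup-++ˡ S T zero) (lookup-++ʳ S T (cent H))))
        (monoEdges-cong (size H) (SHAdj H) (lookup-++ʳ S T))

    fibreSum-SH : ∀ H b → fibreSum (weight (SHAdj H)) (λ s → lookup s (cent H)) b ≈ rootedZ H b
    fibreSum-SH []      true  = trans (+-cong (*-identityˡ _) (+-identityʳ 0#)) (+-identityʳ _)
    fibreSum-SH []      false = trans (+-identityˡ _) (trans (+-identityʳ _) (*-identityˡ 1#))
    fibreSum-SH (h ∷ H) b = begin
      ∑ₛ (suc h ℕ.+ size H) (λ s → select b (lookup s (cent (h ∷ H))) (weight (SHAdj (h ∷ H)) s))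
        ≈⟨ ∑ₛ-++ (suc h) (size H) _ ⟩
      ∑ₛ (suc h) (λ S → ∑ₛ (size H) (λ T → select b (lookup (S ++ T) (cent (h ∷ H))) (weight (SHAdj (h ∷ H)) (S ++ T))))
        ≈⟨ ∑ₗ-cong (allSubsets (suc h)) (λ S → ∑ₗ-cong (allSubsets (size H)) (split S)) ⟩
      ∑ₛ (suc h) (λ S → ∑ₛ (size H) (λ T → (weight (starAdj h) S * t ^ agree (lookup S zero) b)
                                             * select b (lookup T (cent H)) (weight (SHAdj H) T)))
        ≈⟨ ∑ₗ-cong (allSubsets (suc h)) (λ S → trans (∑ₗ-*ˡ (allSubsets (size H)) _ _) (*-congˡ (fibreSum-SH H b))) ⟩
      ∑ₛ (suc h) (λ S → (weight (starAdj h) S * t ^ agree (lookup S zero) b) * rootedZ H b)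
        ≈⟨ ∑ₗ-*ʳ (allSubsets (suc h)) _ _ ⟩
      starSum h b * rootedZ H b
        ≈⟨ starSum-rootedZ h H b ⟩
      rootedZ (h ∷ H) b ∎
      where
      split : ∀ S T →
        select b (lookup (S ++ T) (cent (h ∷ H))) (weight (SHAdj (h ∷ H)) (S ++ T))
        ≈ (weight (starAdj h) S * t ^ agree (lookup S zero) b) * select b (lookup T (cent H)) (weight (SHAdj H) T)
      split S T = begin
        select b (lookup (S ++ T) (cent (h ∷ H))) (weight (SHAdj (h ∷ H)) (S ++ T))
          ≡⟨ ≡.cong (λ c → select b c (weight (SHAdj (h ∷ H)) (S ++ T))) (lookup-++ʳ S T (cent H)) ⟩
        select b (lookup T (cent H)) (weight (SHAdj (h ∷ H)) (S ++ T))
          ≈⟨ select-cong b (lookup T (cent H)) (weight-SH∷ h H S T) ⟩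
        select b (lookup T (cent H)) (t ^ agree (lookup S zero) (lookup T (cent H)) * (weight (starAdj h) S * weight (SHAdj H) T))
          ≈⟨ select-factor b (lookup T (cent H)) (λ c → t ^ agree (lookup S zero) c) _ ⟩
        t ^ agree (lookup S zero) b * select b (lookup T (cent H)) (weight (starAdj h) S * weight (SHAdj H) T)
          ≈⟨ *-congˡ (select-factor b (lookup T (cent H)) (λ _ → weight (starAdj h) S) _) ⟩
        t ^ agree (lookup S zero) b * (weight (starAdj h) S * select b (lookup T (cent H)) (weight (SHAdj H) T))
          ≈⟨ trans (x∙yz≈y∙xz _ _ _) (sym (*-assoc _ _ _)) ⟩
        (weight (starAdj h) S * t ^ agree (lookup S zero) b) * select b (lookup T (cent H)) (weight (SHAdj H) T) ∎

    weight-rooted : ∀ H {n} (g : Adj n) → (∀ v → g v v ≡ false) → (S : Subset (n ℕ.* size H)) →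
      weight (rootedAdj g H) S
      ≈ ∏ n (weight (SHAdj H) ∘ block (size H) S) * t ^ monoEdges n g (lookup (tabulate (λ v → lookup (block (size H) S v) (cent H))))
    weight-rooted H {n} g irr S = begin
      t ^ monoEdges (n ℕ.* m) (rootedAdj g H) (lookup S) * y ^ ∣ S ∣
        ≈⟨ reflexive (≡.cong₂ (λ k l → t ^ k * y ^ l)
             (monoEdges-rooted H n g irr (lookup S)) (≡.trans (∣S∣≡∑ (n ℕ.* m) S) (∑-combine n m _))) ⟩
      t ^ (∑ n mono ℕ.+ monoEdges n g centre) * y ^ ∑ n card
        ≈⟨ *-cong (trans (^-+ t (∑ n mono) _) (*-congʳ (^-∑ t n mono))) (^-∑ y n card) ⟩
      (∏ n (λ v → t ^ mono v) * t ^ monoEdges n g centre) * ∏ n (λ v → y ^ card v)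
        ≈⟨ trans (xy∙z≈xz∙y _ _ _) (*-congʳ (sym (∏-* n _ _))) ⟩
      ∏ n (λ v → t ^ mono v * y ^ card v) * t ^ monoEdges n g centre
        ≈⟨ sym (*-cong (∏-cong n (λ v → reflexive (weight-block v)))
                       (reflexive (≡.cong (t ^_) (monoEdges-cong n g (λ v →
                          ≡.trans (lookup∘tabulate _ v) (lookup∘tabulate _ (cent H))))))) ⟩
      ∏ n (weight (SHAdj H) ∘ block m S) * t ^ monoEdges n g (lookup (tabulate (λ v → lookup (block m S v) (cent H)))) ∎
      where
      m = size H
      mono card : Fin n → ℕ
      mono v = monoEdges m (SHAdj H) (lookup S ∘ combine v)
      card v = ∑ m (iverson ∘ lookup S ∘ combine v)
      centre : Fin n → Bool
      centre v = lookup S (combine v (cent H))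
      weight-block : ∀ v → weight (SHAdj H) (block m S v) ≡ t ^ mono v * y ^ card v
      weight-block v = ≡.cong₂ (λ k l → t ^ k * y ^ l)
        (monoEdges-cong m (SHAdj H) (lookup∘tabulate _))
        (≡.trans (∣S∣≡∑ m (block m S v)) (∑-cong m (λ a → ≡.cong iverson (lookup∘tabulate _ a))))

    Z-rooted : ∀ H {n} (g : Adj n) → (∀ v → g v v ≡ false) →
      Z R (rootedAdj g H) t y ≈ ∑ₛ n (λ r → t ^ monoEdges n g (lookup r) * ∏ n (rootedZ H ∘ lookup r))
    Z-rooted H {n} g irr = begin
      Z R (rootedAdj g H) t y
        ≈⟨ Z≈∑ₛweight (rootedAdj g H) ⟩
      ∑ₛ (n ℕ.* size H) (weight (rootedAdj g H))
        ≈⟨ ∑ₗ-cong (allSubsets (n ℕ.* size H)) (weight-rooted H g irr) ⟩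
      ∑ₛ (n ℕ.* size H) (λ S → ∏ n (weight (SHAdj H) ∘ block (size H) S)
                              * t ^ monoEdges n g (lookup (tabulate (λ v → lookup (block (size H) S v) (cent H)))))
        ≈⟨ ∑ₛ-blocks (weight (SHAdj H)) (λ s → lookup s (cent H)) n (λ r → t ^ monoEdges n g (lookup r)) ⟩
      ∑ₛ n (λ r → t ^ monoEdges n g (lookup r) * ∏ n (fibreSum (weight (SHAdj H)) (λ s → lookup s (cent H)) ∘ lookup r))
        ≈⟨ ∑ₗ-cong (allSubsets n) (λ r → *-congˡ (∏-cong n (λ v → fibreSum-SH H (lookup r v)))) ⟩
      ∑ₛ n (λ r → t ^ monoEdges n g (lookup r) * ∏ n (rootedZ H ∘ lookup r)) ∎

    rootedZ-true : ∀ H (inv : ℕ → Carrier) → (∀ h → h ∈ H → den R t y h * inv h ≈ 1#) →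
      rootedZ H true ≈ Π-list R (map (den R t y) H) * g-y R H inv t y
    rootedZ-true H inv den*inv≈1 = trans (*-congˡ (sym (cancel H den*inv≈1))) (x∙yz≈y∙xz _ _ _)
      where
      cancel : ∀ H → (∀ h → h ∈ H → den R t y h * inv h ≈ 1#) →
        Π-list R (map (den R t y) H) * Π-list R (map (λ h → num R t y h * inv h) H) ≈ Π-list R (map (num R t y) H)
      cancel []      _          = *-identityˡ 1#
      cancel (h ∷ H) den*inv≈1 = begin
        (den R t y h * D) * ((num R t y h * inv h) * Q)
          ≈⟨ solve 5 (λ d D u i Q → (d :* D) :* ((u :* i) :* Q) := u :* ((d :* i) :* (D :* Q))) refl _ _ _ _ _ ⟩
        num R t y h * ((den R t y h * inv h) * (D * Q))
          ≈⟨ *-congˡ (trans (*-congʳ (den*inv≈1 h (here ≡.refl))) (*-identityˡ _)) ⟩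
        num R t y h * (D * Q)
          ≈⟨ *-congˡ (cancel H (λ h′ h′∈H → den*inv≈1 h′ (there h′∈H))) ⟩
        num R t y h * Π-list R (map (num R t y) H) ∎
        where
        D = Π-list R (map (den R t y) H)
        Q = Π-list R (map (λ h → num R t y h * inv h) H)

mainTheorem10 : (R : CommutativeRing 0ℓ 0ℓ) →
    let open CommutativeRing R in
    (H : List ℕ) → Unique H → All (1 ≤_) H →
    {n : ℕ} (G : SimpleGraph n) →
    (t y : Carrier) (inv : ℕ → Carrier) →
    (∀ h → h ∈ H → den R t y h * inv h ≈ 1#) →
    Z R (rootedAdj (adj G) H) t y
      ≈ g-p R H n t y * Z R (adj G) t (g-y R H inv t y)
mainTheorem10 R H _ _ {n} G t y inv den*inv≈1 = begin
  Z R (rootedAdj (adj G) H) t y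
    ≈⟨ Z-rooted t y H (adj G) (adj-irr G) ⟩
  ∑ₛ n (λ r → t ^ monoEdges n (adj G) (lookup r) * ∏ n (rootedZ t y H ∘ lookup r))
    ≈⟨ ∑ₗ-cong (allSubsets n) (λ r → *-congˡ
         (∏-lookup (rootedZ t y H) (rootedZ-true t y H inv den*inv≈1) refl r)) ⟩
  ∑ₛ n (λ r → t ^ monoEdges n (adj G) (lookup r) * (D ^ n * gy ^ ∣ r ∣))
    ≈⟨ trans (∑ₗ-cong (allSubsets n) (λ r → x∙yz≈y∙xz _ _ _)) (∑ₗ-*ˡ (allSubsets n) _ _) ⟩
  D ^ n * ∑ₛ n (weight t gy (adj G))
    ≈⟨ *-congˡ (sym (Z≈∑ₛweight t gy (adj G))) ⟩
  g-p R H n t y * Z R (adj G) t gy ∎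
  where
  open CommutativeRing R hiding (zero)
  open RingSums R
  open import Relation.Binary.Reasoning.Setoid setoid
  open import Algebra.Properties.CommutativeSemigroup *-commutativeSemigroup using (x∙yz≈y∙xz)
  D = Π-list R (map (den R t y) H)
  gy = g-y R H inv t y
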